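{- For every $k\ge1$, the tidy series permutation evaluations of the syntax trees on $\mathcal{O}_k$ are precisely the fully $k$-rooted cuttable $k$-permutations: a $k$-permutation $\rho$ equals $\mathrm{TEval}(t)$ for some syntax tree $t$ if and only if $\rho$ is fully $k$-rooted cuttable.
   Context: A $k$-permutation of degree $n$ is a word on the multiset $\{1^k,\dots,n^k\}$; $\mathrm{Perm}_k(n)$ is their set. $\nu[m]$ adds $m$ to each letter. For $\omega\in\{\prec,\succ\}^*$ and words $X,Y$ with $|\omega|\le\min(|X|,|Y|)$: $X\,\varepsilon\,Y=XY$; $X\,(\prec\omega')\,Y=x(X'\,\omega'\,Y)$ if $X=xX'$; $X\,(\succ\omega')\,Y=y(X\,\omega'\,Y')$ if $Y=yY'$. For $\omega\in\mathcal{O}_k=\{\prec,\succ\}^k$, $\mu\in\mathrm{Perm}_k(m)$, $\nu\in\mathrm{Perm}_k(n)$, set $\mu\,\omega\,\nu:=\mu\,\omega\,\nu[m]$. A syntax tree on $\mathcal{O}_k$ is a planar binary tree with internal nodes labeled by $\mathcal{O}_k$. Its tidy series permutation evaluation $\mathrm{TEval}(t)$ is defined recursively: a leaf evaluates to the $k$-permutation $1^k=11\cdots1$ of degree $1$, and a tree with root label $\omega$, left subtree $l$ and right subtree $r$ evaluates to $\mathrm{TEval}(l)\,\omega\,\mathrm{TEval}(r)$. Restriction: for $\sigma\in\mathrm{Perm}_k(n)$ and $L=\{\ell_1<\dots<\ell_q\}\subseteq[n]$, $\sigma^{|L}$ is obtained by keeping only the letters in $L$ and replacing $\ell_x$ by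 $x$. $\gamma\in[n-1]$ is a $k$-rooted cut of $\sigma$ if $\sigma=\alpha\beta\delta$ with $|\alpha|=k$, all letters of $\beta$ at most $\gamma$, all letters of $\delta$ greater than $\gamma$; $\sigma$ is $k$-rooted cuttable if it has a $k$-rooted cut. $\sigma$ is fully $k$-rooted cuttable if $\sigma^{|[a,b]}$ is $k$-rooted cuttable for every interval $[a,b]\subseteq[n]$ with $a<b$ (equivalently, $\sigma^{|L}$ is $k$-rooted cuttable for every $L\subseteq[n]$ with $|L|\ge2$). -}

module Defs where

open import Data.Nat using (ℕ; zero; suc; _+_; _∸_; _≤_; _<_; _≤?_)
open import Data.List using (List; []; _∷_; _++_; map; filter; replicate; length)
open import Data.List.Relation.Unary.All using (All)
open import Data.Vec using (Vec; toList)
open import Data.Product using (Σ; ∃; _×_; _,_)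
open import Relation.Nullary.Decidable using (_×-dec_)
open import Relation.Binary.PropositionalEquality using (_≡_)
open import Relation.Unary using (Decidable)
open import Data.Nat.Properties using (_≟_)

Word : Set
Word = List ℕ

IsKPerm : ℕ → ℕ → Word → Set
IsKPerm k n σ =
  All (λ x → 1 ≤ x × x ≤ n) σ ×
  (∀ i → 1 ≤ i → i ≤ n → length (filter (_≟ i) σ) ≡ k)

data Dir : Set where
  ≺ ≻ : Dir

Op : ℕ → Set
Op k = Vec Dir k

-- X ω Y on words.  Only meaningful when |ω| ≤ min(|X|,|Y|); the clauses for a
-- too-short argument are an arbitrary total completion never reached in TEval.
shuffle : List Dir → Word → Word → Word
shuffle []      X       Y       = X ++ Y
shuffle (≺ ∷ ω) (x ∷ X) Y       = x ∷ shuffle ω X Y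
shuffle (≺ ∷ ω) []      Y       = Y
shuffle (≻ ∷ ω) X       (y ∷ Y) = y ∷ shuffle ω X Y
shuffle (≻ ∷ ω) X       []      = X

shift : ℕ → Word → Word
shift m = map (m +_)

data Tree (k : ℕ) : Set where
  leaf : Tree k
  node : Op k → Tree k → Tree k → Tree k

degree : ∀ {k} → Tree k → ℕ
degree leaf         = 1
degree (node _ l r) = degree l + degree r

TEval : (k : ℕ) → Tree k → Word
TEval k leaf         = replicate k 1
TEval k (node ω l r) = shuffle (toList ω) (TEval k l) (shift (degree l) (TEval k r))

restrict : ℕ → ℕ → Word → Word
restrict a b σ = map (λ x → suc (x ∸ a)) (filter (λ x → (a ≤? x) ×-dec (x ≤? b)) σ)

IsKRootedCut : ℕ → ℕ → Word → ℕ → Set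
IsKRootedCut k n σ γ =
  1 ≤ γ × suc γ ≤ n ×
  Σ Word λ α → Σ Word λ β → Σ Word λ δ →
    (σ ≡ α ++ β ++ δ) × length α ≡ k ×
    All (λ x → x ≤ γ) β × All (λ x → γ < x) δ

KRootedCuttable : ℕ → ℕ → Word → Set
KRootedCuttable k n σ = ∃ λ γ → IsKRootedCut k n σ γ

FullyKRootedCuttable : ℕ → ℕ → Word → Set
FullyKRootedCuttable k n σ =
  ∀ a b → 1 ≤ a → a < b → b ≤ n → KRootedCuttable k (suc (b ∸ a)) (restrict a b σ)

-- Forward: restrict TEval t to an interval [a, b]. If [a, b] lies within the letters of one
-- subtree, the restriction is the restriction of that subtree's evaluation (up to the shift), so
-- induction applies. Otherwise a ≤ m < b for the degree m of the left subtree; the root operator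
-- emits at most k letters, after which the word is a suffix of the left evaluation (letters ≤ m)
-- followed by a suffix of the shifted right one (letters > m), so m - a + 1 is a k-rooted cut.
--
-- Backward, by strong induction on the degree: a k-rooted cut γ of ρ writes ρ = αβδ, and ρ is
-- the shuffle of its restrictions to [1, γ] and [γ + 1, n] under the operator that records, for
-- each letter of α, on which side of the cut it lies. Both restrictions are again fully k-rooted
-- cuttable k-permutations.
module Submission where

open import Defs
open import Data.Nat using (ℕ; zero; suc; _+_; _∸_; _≤_; _<_; _≤?_; _<?_; z≤n; s≤s)
open import Data.Nat.Properties
open import Data.Nat.Induction using (<-rec)
open import Data.List using (List; []; _∷_; _++_; [_]; map; filter; replicate; length)
open import Data.List.Properties
  using (filter-accept; filter-reject; filter-++; filter-all; filter-none; filter-≐; length-filter;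
         map-++; map-∘; map-id; map-id-local; length-map; length-replicate; ++-identityʳ)
open import Data.List.Relation.Unary.All as All using (All; []; _∷_)
open import Data.List.Relation.Unary.All.Properties
  using (++⁺; ++⁻ˡ; ++⁻ʳ; map⁺; filter⁺; all-filter; replicate⁺)
open import Data.Vec using (Vec; toList; fromList)
open import Data.Vec.Properties using (length-toList; toList∘fromList)
open import Data.Product using (Σ; ∃; _×_; _,_; proj₁; proj₂)
open import Data.Empty using (⊥-elim)
open import Function.Base using (_∘_)
open import Function.Bundles using (_⇔_; mk⇔; Equivalence)
open import Relation.Binary.PropositionalEquality
  using (_≡_; refl; sym; trans; cong; cong₂; subst; subst₂; module ≡-Reasoning)
open import Relation.Nullary using (yes; no; ¬_)
open import Relation.Nullary.Decidable using (_×-dec_)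
open import Relation.Unary using (Decidable; ∁)

open ≡-Reasoning

InRange : ℕ → ℕ → ℕ → Set
InRange a b x = a ≤ x × x ≤ b

inRange? : ∀ a b → Decidable (InRange a b)
inRange? a b x = (a ≤? x) ×-dec (x ≤? b)

m≤o∸n⇒n+m≤o : ∀ {m n o} → n ≤ o → m ≤ o ∸ n → n + m ≤ o
m≤o∸n⇒n+m≤o {n = n} n≤o m≤o∸n = ≤-trans (+-monoʳ-≤ n m≤o∸n) (≤-reflexive (m+[n∸m]≡n n≤o))

m+[1+[n∸1+m]]≡n : ∀ {m n} → m < n → m + suc (n ∸ suc m) ≡ n
m+[1+[n∸1+m]]≡n {m} m<n = trans (+-suc m _) (m+[n∸m]≡n m<n)

inRange-relabel : ∀ {a a' b' x} → a ≤ x →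
  InRange (suc a') (suc b') (suc (x ∸ a)) ⇔ InRange (a + a') (a + b') x
inRange-relabel {a} {a'} {b'} {x} a≤x = mk⇔
  (λ { (s≤s a'≤x∸a , s≤s x∸a≤b') →
          ≤-trans (+-monoʳ-≤ a a'≤x∸a) (≤-reflexive x≡) ,
          ≤-trans (≤-reflexive (sym x≡)) (+-monoʳ-≤ a x∸a≤b') })
  (λ { (a+a'≤x , x≤a+b') →
          s≤s (subst (_≤ x ∸ a) (m+n∸m≡n a a') (∸-monoˡ-≤ a a+a'≤x)) ,
          s≤s (m≤n+o⇒m∸n≤o x a x≤a+b') })
  where
  x≡ : a + (x ∸ a) ≡ x
  x≡ = m+[n∸m]≡n a≤x

All-≡⇒replicate : ∀ {x : ℕ} {xs} → All (_≡ x) xs → xs ≡ replicate (length xs) x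
All-≡⇒replicate [] = refl
All-≡⇒replicate (refl ∷ ps) = cong (_ ∷_) (All-≡⇒replicate ps)

vec-of-length : ∀ {A : Set} {k} (xs : List A) → length xs ≡ k → Σ (Vec A k) λ v → toList v ≡ xs
vec-of-length xs refl = fromList xs , toList∘fromList xs

-- Restriction to an interval

restrict-∷⁺ : ∀ {a b x} xs → InRange a b x → restrict a b (x ∷ xs) ≡ suc (x ∸ a) ∷ restrict a b xs
restrict-∷⁺ {a} {b} _ x∈ = cong (map (λ x → suc (x ∸ a))) (filter-accept (inRange? a b) x∈)

restrict-∷⁻ : ∀ {a b x} xs → ¬ InRange a b x → restrict a b (x ∷ xs) ≡ restrict a b xs
restrict-∷⁻ {a} {b} _ x∉ = cong (map (λ x → suc (x ∸ a))) (filter-reject (inRange? a b) x∉)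

restrict-++ : ∀ a b xs ys → restrict a b (xs ++ ys) ≡ restrict a b xs ++ restrict a b ys
restrict-++ a b xs ys =
  trans (cong (map (λ x → suc (x ∸ a))) (filter-++ (inRange? a b) xs ys))
    (map-++ _ (filter (inRange? a b) xs) (filter (inRange? a b) ys))

restrict-++-++ : ∀ a b xs ys zs →
  restrict a b (xs ++ ys ++ zs) ≡ restrict a b xs ++ restrict a b ys ++ restrict a b zs
restrict-++-++ a b xs ys zs =
  trans (restrict-++ a b xs (ys ++ zs)) (cong (restrict a b xs ++_) (restrict-++ a b ys zs))

restrict-none : ∀ {a b xs} → All (∁ (InRange a b)) xs → restrict a b xs ≡ []
restrict-none {a} {b} xs∉ = cong (map (λ x → suc (x ∸ a))) (filter-none (inRange? a b) xs∉)

restrict-All : ∀ {P Q : ℕ → Set} {a b xs} → (∀ {x} → P x → InRange a b x → Q (suc (x ∸ a))) →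
  All P xs → All Q (restrict a b xs)
restrict-All {a = a} {b} {xs} f ps =
  map⁺ (All.zipWith (λ (p , x∈) → f p x∈) (filter⁺ (inRange? a b) ps , all-filter (inRange? a b) xs))

length-restrict-≤ : ∀ a b xs → length (restrict a b xs) ≤ length xs
length-restrict-≤ a b xs =
  subst (_≤ length xs) (sym (length-map (λ x → suc (x ∸ a)) (filter (inRange? a b) xs)))
    (length-filter (inRange? a b) xs)

shift-restrict : ∀ {a b xs} → All (InRange (suc a) b) xs → shift a (restrict (suc a) b xs) ≡ xs
shift-restrict {a} {b} {xs} xs∈ = begin
  map (a +_) (map (λ x → suc (x ∸ suc a)) (filter (inRange? (suc a) b) xs))
    ≡⟨ cong (map (a +_) ∘ map (λ x → suc (x ∸ suc a))) (filter-all (inRange? (suc a) b) xs∈) ⟩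
  map (a +_) (map (λ x → suc (x ∸ suc a)) xs)
    ≡⟨ map-∘ xs ⟨
  map (λ x → a + suc (x ∸ suc a)) xs
    ≡⟨ map-id-local (All.map (λ (a<x , _) → m+[1+[n∸1+m]]≡n a<x) xs∈) ⟩
  xs ∎

restrict-id : ∀ {n xs} → All (InRange 1 n) xs → restrict 1 n xs ≡ xs
restrict-id xs∈ = trans (sym (map-id _)) (shift-restrict xs∈)

restrict-shift : ∀ m a b xs → restrict (m + a) (m + b) (shift m xs) ≡ restrict a b xs
restrict-shift m a b [] = refl
restrict-shift m a b (x ∷ xs) with inRange? a b x
... | yes x∈@(a≤x , x≤b) = begin
  restrict (m + a) (m + b) (m + x ∷ shift m xs)
    ≡⟨ restrict-∷⁺ (shift m xs) (+-monoʳ-≤ m a≤x , +-monoʳ-≤ m x≤b) ⟩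
  suc (m + x ∸ (m + a)) ∷ restrict (m + a) (m + b) (shift m xs)
    ≡⟨ cong₂ (λ d ys → suc d ∷ ys) ([m+n]∸[m+o]≡n∸o m x a) (restrict-shift m a b xs) ⟩
  suc (x ∸ a) ∷ restrict a b xs
    ≡⟨ restrict-∷⁺ xs x∈ ⟨
  restrict a b (x ∷ xs) ∎
... | no x∉ = begin
  restrict (m + a) (m + b) (m + x ∷ shift m xs)
    ≡⟨ restrict-∷⁻ (shift m xs) (λ (p , q) → x∉ (+-cancelˡ-≤ m a x p , +-cancelˡ-≤ m x b q)) ⟩
  restrict (m + a) (m + b) (shift m xs)
    ≡⟨ restrict-shift m a b xs ⟩
  restrict a b xs
    ≡⟨ restrict-∷⁻ xs x∉ ⟨
  restrict a b (x ∷ xs) ∎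

restrict-restrict : ∀ {a b a' b'} xs → a ≤ b → b' ≤ b ∸ a →
  restrict (suc a') (suc b') (restrict a b xs) ≡ restrict (a + a') (a + b') xs
restrict-restrict [] _ _ = refl
restrict-restrict {a} {b} {a'} {b'} (x ∷ xs) a≤b b'≤b∸a
  with inRange? a b x | inRange? (a + a') (a + b') x
... | yes x∈ | yes x∈' = begin
  restrict (suc a') (suc b') (restrict a b (x ∷ xs))
    ≡⟨ cong (restrict (suc a') (suc b')) (restrict-∷⁺ xs x∈) ⟩
  restrict (suc a') (suc b') (suc (x ∸ a) ∷ restrict a b xs)
    ≡⟨ restrict-∷⁺ (restrict a b xs) (Equivalence.from (inRange-relabel (proj₁ x∈)) x∈') ⟩
  suc (x ∸ a ∸ a') ∷ restrict (suc a') (suc b') (restrict a b xs)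
    ≡⟨ cong₂ (λ d ys → suc d ∷ ys) (∸-+-assoc x a a') (restrict-restrict xs a≤b b'≤b∸a) ⟩
  suc (x ∸ (a + a')) ∷ restrict (a + a') (a + b') xs
    ≡⟨ restrict-∷⁺ xs x∈' ⟨
  restrict (a + a') (a + b') (x ∷ xs) ∎
... | yes x∈ | no x∉' = begin
  restrict (suc a') (suc b') (restrict a b (x ∷ xs))
    ≡⟨ cong (restrict (suc a') (suc b')) (restrict-∷⁺ xs x∈) ⟩
  restrict (suc a') (suc b') (suc (x ∸ a) ∷ restrict a b xs)
    ≡⟨ restrict-∷⁻ (restrict a b xs) (x∉' ∘ Equivalence.to (inRange-relabel (proj₁ x∈))) ⟩
  restrict (suc a') (suc b') (restrict a b xs)
    ≡⟨ restrict-restrict xs a≤b b'≤b∸a ⟩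
  restrict (a + a') (a + b') xs
    ≡⟨ restrict-∷⁻ xs x∉' ⟨
  restrict (a + a') (a + b') (x ∷ xs) ∎
... | no x∉ | yes (a+a'≤x , x≤a+b') =
  ⊥-elim (x∉ (≤-trans (m≤m+n a a') a+a'≤x , ≤-trans x≤a+b' (m≤o∸n⇒n+m≤o a≤b b'≤b∸a)))
... | no x∉ | no x∉' = begin
  restrict (suc a') (suc b') (restrict a b (x ∷ xs))
    ≡⟨ cong (restrict (suc a') (suc b')) (restrict-∷⁻ xs x∉) ⟩
  restrict (suc a') (suc b') (restrict a b xs)
    ≡⟨ restrict-restrict xs a≤b b'≤b∸a ⟩
  restrict (a + a') (a + b') xs
    ≡⟨ restrict-∷⁻ xs x∉' ⟨
  restrict (a + a') (a + b') (x ∷ xs) ∎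

length-filter-≟ : ∀ i xs → length (filter (_≟ i) xs) ≡ length (restrict i i xs)
length-filter-≟ i xs = begin
  length (filter (_≟ i) xs)          ≡⟨ cong length (filter-≐ (_≟ i) (inRange? i i) (x≡i⇒ , ⇒x≡i) xs) ⟩
  length (filter (inRange? i i) xs)  ≡⟨ length-map (λ x → suc (x ∸ i)) (filter (inRange? i i) xs) ⟨
  length (restrict i i xs)           ∎
  where
  x≡i⇒ : ∀ {x} → x ≡ i → InRange i i x
  x≡i⇒ refl = ≤-refl , ≤-refl
  ⇒x≡i : ∀ {x} → InRange i i x → x ≡ i
  ⇒x≡i (i≤x , x≤i) = ≤-antisym x≤i i≤x

isKPerm-length : ∀ {k n σ} → 1 ≤ n → IsKPerm k n σ → k ≤ length σ
isKPerm-length {σ = σ} 1≤n (_ , count) =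
  subst (_≤ length σ) (count 1 ≤-refl 1≤n) (length-filter (_≟ 1) σ)

isKPerm-degree-one : ∀ {k ρ} → IsKPerm k 1 ρ → ρ ≡ replicate k 1
isKPerm-degree-one {k} {ρ} (ρ∈ , count) = begin
  ρ                          ≡⟨ All-≡⇒replicate ones ⟩
  replicate (length ρ) 1     ≡⟨ cong (λ n → replicate n 1) |ρ|≡k ⟩
  replicate k 1              ∎
  where
  ones : All (_≡ 1) ρ
  ones = All.map (λ (1≤x , x≤1) → ≤-antisym x≤1 1≤x) ρ∈
  |ρ|≡k : length ρ ≡ k
  |ρ|≡k = trans (cong length (sym (filter-all (_≟ 1) ones))) (count 1 ≤-refl ≤-refl)

isKPerm-restrict : ∀ {k n ρ a b} → IsKPerm k n ρ → 1 ≤ a → a ≤ b → b ≤ n →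
  IsKPerm k (suc (b ∸ a)) (restrict a b ρ)
isKPerm-restrict {k} {ρ = ρ} {a} {b} (ρ∈ , count) 1≤a a≤b b≤n =
  restrict-All (λ _ (_ , x≤b) → s≤s z≤n , s≤s (∸-monoˡ-≤ a x≤b)) ρ∈ , count′
  where
  count′ : ∀ i → 1 ≤ i → i ≤ suc (b ∸ a) → length (filter (_≟ i) (restrict a b ρ)) ≡ k
  count′ (suc i) _ (s≤s i≤b∸a) = begin
    length (filter (_≟ suc i) (restrict a b ρ))      ≡⟨ length-filter-≟ (suc i) (restrict a b ρ) ⟩
    length (restrict (suc i) (suc i) (restrict a b ρ)) ≡⟨ cong length (restrict-restrict ρ a≤b i≤b∸a) ⟩
    length (restrict (a + i) (a + i) ρ)              ≡⟨ length-filter-≟ (a + i) ρ ⟨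
    length (filter (_≟ a + i) ρ)                     ≡⟨ count (a + i) (≤-trans 1≤a (m≤m+n a i))
                                                          (≤-trans (m≤o∸n⇒n+m≤o a≤b i≤b∸a) b≤n) ⟩
    k                                                ∎

fullyKRootedCuttable-restrict : ∀ {k n ρ a b} → FullyKRootedCuttable k n ρ → 1 ≤ a → a ≤ b → b ≤ n →
  FullyKRootedCuttable k (suc (b ∸ a)) (restrict a b ρ)
fullyKRootedCuttable-restrict {k} {ρ = ρ} {a} F 1≤a a≤b b≤n
  (suc a') (suc b') _ (s≤s a'<b') (s≤s b'≤b∸a) =
  subst₂ (KRootedCuttable k) (cong suc ([m+n]∸[m+o]≡n∸o a b' a'))
    (sym (restrict-restrict ρ a≤b b'≤b∸a))
    (F (a + a') (a + b') (≤-trans 1≤a (m≤m+n a a')) (+-monoʳ-< a a'<b')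
       (≤-trans (m≤o∸n⇒n+m≤o a≤b b'≤b∸a) b≤n))

-- Shuffles

module _ {P : ℕ → Set} (P? : Decidable P) where

  filter-shuffleˡ : ∀ w {X Y} → All (∁ P) Y → filter P? (shuffle w X Y) ≡ filter P? X
  filter-shuffleˡ [] {X} {Y} Y∉ = begin
    filter P? (X ++ Y)              ≡⟨ filter-++ P? X Y ⟩
    filter P? X ++ filter P? Y      ≡⟨ cong (filter P? X ++_) (filter-none P? Y∉) ⟩
    filter P? X ++ []               ≡⟨ ++-identityʳ (filter P? X) ⟩
    filter P? X                     ∎
  filter-shuffleˡ (≺ ∷ w) {x ∷ X} {Y} Y∉ = begin
    filter P? (x ∷ shuffle w X Y)               ≡⟨ filter-++ P? [ x ] (shuffle w X Y) ⟩
    filter P? [ x ] ++ filter P? (shuffle w X Y) ≡⟨ cong (filter P? [ x ] ++_) (filter-shuffleˡ w Y∉) ⟩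
    filter P? [ x ] ++ filter P? X              ≡⟨ filter-++ P? [ x ] X ⟨
    filter P? (x ∷ X)                           ∎
  filter-shuffleˡ (≺ ∷ w) {[]} Y∉ = filter-none P? Y∉
  filter-shuffleˡ (≻ ∷ w) {X} {y ∷ Y} (y∉ ∷ Y∉) = trans (filter-reject P? y∉) (filter-shuffleˡ w Y∉)
  filter-shuffleˡ (≻ ∷ w) {X} {[]} _ = refl

  filter-shuffleʳ : ∀ w {X Y} → All (∁ P) X → filter P? (shuffle w X Y) ≡ filter P? Y
  filter-shuffleʳ [] {X} {Y} X∉ = trans (filter-++ P? X Y) (cong (_++ filter P? Y) (filter-none P? X∉))
  filter-shuffleʳ (≺ ∷ w) {x ∷ X} (x∉ ∷ X∉) = trans (filter-reject P? x∉) (filter-shuffleʳ w X∉)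
  filter-shuffleʳ (≺ ∷ w) {[]} _ = refl
  filter-shuffleʳ (≻ ∷ w) {X} {y ∷ Y} X∉ = begin
    filter P? (y ∷ shuffle w X Y)               ≡⟨ filter-++ P? [ y ] (shuffle w X Y) ⟩
    filter P? [ y ] ++ filter P? (shuffle w X Y) ≡⟨ cong (filter P? [ y ] ++_) (filter-shuffleʳ w X∉) ⟩
    filter P? [ y ] ++ filter P? Y              ≡⟨ filter-++ P? [ y ] Y ⟨
    filter P? (y ∷ Y)                           ∎
  filter-shuffleʳ (≻ ∷ w) {X} {[]} X∉ = filter-none P? X∉

restrict-shuffleˡ : ∀ {a b} w {X Y} → All (∁ (InRange a b)) Y →
  restrict a b (shuffle w X Y) ≡ restrict a b X
restrict-shuffleˡ {a} {b} w Y∉ = cong (map (λ x → suc (x ∸ a))) (filter-shuffleˡ (inRange? a b) w Y∉)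

restrict-shuffleʳ : ∀ {a b} w {X Y} → All (∁ (InRange a b)) X →
  restrict a b (shuffle w X Y) ≡ restrict a b Y
restrict-shuffleʳ {a} {b} w X∉ = cong (map (λ x → suc (x ∸ a))) (filter-shuffleʳ (inRange? a b) w X∉)

shuffle-All : ∀ {P : ℕ → Set} w {X Y} → All P X → All P Y → All P (shuffle w X Y)
shuffle-All []      pX       pY       = ++⁺ pX pY
shuffle-All (≺ ∷ w) (p ∷ pX) pY       = p ∷ shuffle-All w pX pY
shuffle-All (≺ ∷ w) []       pY       = pY
shuffle-All (≻ ∷ w) pX       (p ∷ pY) = p ∷ shuffle-All w pX pY
shuffle-All (≻ ∷ w) pX       []       = pX

shuffle-splits : ∀ {P Q : ℕ → Set} w {X Y} → All P X → All Q Y →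
  Σ Word λ R → Σ Word λ X' → Σ Word λ Y' →
    shuffle w X Y ≡ R ++ X' ++ Y' × length R ≤ length w × All P X' × All Q Y'
shuffle-splits [] {X} {Y} pX qY = [] , X , Y , refl , z≤n , pX , qY
shuffle-splits (≺ ∷ w) {x ∷ X} (_ ∷ pX) qY with shuffle-splits w pX qY
... | R , X' , Y' , eq , |R|≤ , pX' , qY' = x ∷ R , X' , Y' , cong (x ∷_) eq , s≤s |R|≤ , pX' , qY'
shuffle-splits (≺ ∷ w) {[]} {Y} [] qY = [] , [] , Y , refl , z≤n , [] , qY
shuffle-splits (≻ ∷ w) {X} {y ∷ Y} pX (_ ∷ qY) with shuffle-splits w pX qY
... | R , X' , Y' , eq , |R|≤ , pX' , qY' = y ∷ R , X' , Y' , cong (y ∷_) eq , s≤s |R|≤ , pX' , qY'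
shuffle-splits (≻ ∷ w) {X} {[]} pX [] = [] , X , [] , sym (++-identityʳ X) , z≤n , pX , []

TEval-bounds : ∀ {k} (t : Tree k) → All (InRange 1 (degree t)) (TEval k t)
TEval-bounds {k} leaf = replicate⁺ k (≤-refl , ≤-refl)
TEval-bounds (node ω l r) = shuffle-All (toList ω)
  (All.map (λ (1≤x , x≤m) → 1≤x , m≤n⇒m≤n+o (degree r) x≤m) (TEval-bounds l))
  (map⁺ (All.map (λ (1≤y , y≤d) → m≤n⇒m≤o+n (degree l) 1≤y , +-monoʳ-≤ (degree l) y≤d)
                 (TEval-bounds r)))

TEval-≤-degree : ∀ {k} (t : Tree k) → All (_≤ degree t) (TEval k t)
TEval-≤-degree t = All.map proj₂ (TEval-bounds t)

shift-TEval-> : ∀ {k} m (t : Tree k) → All (m <_) (shift m (TEval k t))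
shift-TEval-> m t = map⁺ (All.map (λ (1≤y , _) → m<m+n m 1≤y) (TEval-bounds t))

-- Evaluations are fully k-rooted cuttable

RootedSplit : ℕ → (ℕ → Set) → (ℕ → Set) → Word → Set
RootedSplit k P Q σ = Σ Word λ α → Σ Word λ β → Σ Word λ δ →
  (σ ≡ α ++ β ++ δ) × length α ≡ k × All P β × All Q δ

rootedSplit-∷ : ∀ {k P Q σ} x → RootedSplit k P Q σ → RootedSplit (suc k) P Q (x ∷ σ)
rootedSplit-∷ x (α , β , δ , eq , |α| , pβ , qδ) =
  x ∷ α , β , δ , cong (x ∷_) eq , cong suc |α| , pβ , qδ

rootedSplit : ∀ {P Q} k R B D → length R ≤ k → k ≤ length (R ++ B ++ D) → All P B → All Q D →
  RootedSplit k P Q (R ++ B ++ D)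
rootedSplit zero    []      B       D       _        _        pB       qD       =
  [] , B , D , refl , refl , pB , qD
rootedSplit (suc k) (x ∷ R) B       D       (s≤s ≤k) (s≤s k≤) pB       qD       =
  rootedSplit-∷ x (rootedSplit k R B D ≤k k≤ pB qD)
rootedSplit (suc k) []      (x ∷ B) D       _        (s≤s k≤) (_ ∷ pB) qD       =
  rootedSplit-∷ x (rootedSplit k [] B D z≤n k≤ pB qD)
rootedSplit (suc k) []      []      (x ∷ D) _        (s≤s k≤) []       (_ ∷ qD) =
  rootedSplit-∷ x (rootedSplit k [] [] D z≤n k≤ [] qD)

straddling-cut : ∀ {k m a b} w {X Y} → length w ≡ k → a ≤ m → m < b →
  All (_≤ m) X → All (m <_) Y → k ≤ length (restrict a b (shuffle w X Y)) →
  KRootedCuttable k (suc (b ∸ a)) (restrict a b (shuffle w X Y))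
straddling-cut {k} {m} {a} {b} w {X} {Y} |w| a≤m m<b X≤m m<Y k≤
  with shuffle-splits w X≤m m<Y
... | R , X' , Y' , eq , |R|≤|w| , X'≤m , m<Y' =
  suc (m ∸ a) , s≤s z≤n , s≤s (∸-monoˡ-< m<b a≤m) ,
  subst (RootedSplit k (_≤ suc (m ∸ a)) (suc (m ∸ a) <_)) (sym pieces)
    (rootedSplit k (restrict a b R) (restrict a b X') (restrict a b Y')
      (≤-trans (length-restrict-≤ a b R) (subst (length R ≤_) |w| |R|≤|w|))
      (subst (λ σ → k ≤ length σ) pieces k≤)
      (restrict-All (λ x≤m _ → s≤s (∸-monoˡ-≤ a x≤m)) X'≤m)
      (restrict-All (λ m<y (a≤y , _) → s≤s (∸-monoˡ-< m<y a≤m)) m<Y'))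
  where
  pieces : restrict a b (shuffle w X Y) ≡ restrict a b R ++ restrict a b X' ++ restrict a b Y'
  pieces = trans (cong (restrict a b) eq) (restrict-++-++ a b R X' Y')

TEval-restrict-cuttable : ∀ {k} (t : Tree k) {a b} → a < b → k ≤ length (restrict a b (TEval k t)) →
  KRootedCuttable k (suc (b ∸ a)) (restrict a b (TEval k t))
TEval-restrict-cuttable {k} leaf {a} {b} a<b k≤ =
  1 , ≤-refl , s≤s (m<n⇒0<n∸m a<b) , W , [] , [] , sym (++-identityʳ W) , |W|≡k , [] , []
  where
  W = restrict a b (replicate k 1)
  |W|≡k : length W ≡ k
  |W|≡k = ≤-antisym (subst (length W ≤_) (length-replicate k) (length-restrict-≤ a b (replicate k 1)))
                    k≤
TEval-restrict-cuttable {k} (node ω l r) {a} {b} a<b k≤ with b ≤? degree l | degree l <? a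
... | yes b≤m | _ =
  subst (KRootedCuttable k (suc (b ∸ a))) (sym to-left)
    (TEval-restrict-cuttable l a<b (subst (λ σ → k ≤ length σ) to-left k≤))
  where
  to-left = restrict-shuffleˡ (toList ω)
    (All.map (λ m<y (_ , y≤b) → <⇒≱ (≤-<-trans b≤m m<y) y≤b) (shift-TEval-> (degree l) r))
... | no b≰m | no m≮a =
  straddling-cut (toList ω) (length-toList ω) (≮⇒≥ m≮a) (≰⇒> b≰m)
    (TEval-≤-degree l) (shift-TEval-> (degree l) r) k≤
... | no _ | yes m<a with m≤n⇒∃[o]m+o≡n (<⇒≤ m<a) | m≤n⇒∃[o]m+o≡n (<⇒≤ (<-trans m<a a<b))
...   | a' , refl | b' , refl =
  subst₂ (KRootedCuttable k) (cong suc (sym ([m+n]∸[m+o]≡n∸o m b' a'))) (sym to-right)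
    (TEval-restrict-cuttable r (+-cancelˡ-< m a' b' a<b) (subst (λ σ → k ≤ length σ) to-right k≤))
  where
  m = degree l
  to-right : restrict (m + a') (m + b') (TEval k (node ω l r)) ≡ restrict a' b' (TEval k r)
  to-right = trans
    (restrict-shuffleʳ (toList ω)
      (All.map (λ x≤m (m+a'≤x , _) → <⇒≱ (<-≤-trans m<a m+a'≤x) x≤m) (TEval-≤-degree l)))
    (restrict-shift m a' b' (TEval k r))

TEval⇒fullyKRootedCuttable : ∀ {k n} (t : Tree k) → IsKPerm k n (TEval k t) →
  FullyKRootedCuttable k n (TEval k t)
TEval⇒fullyKRootedCuttable t t-perm a b 1≤a a<b b≤n =
  TEval-restrict-cuttable t a<b (isKPerm-length (s≤s z≤n) (isKPerm-restrict t-perm 1≤a (<⇒≤ a<b) b≤n))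

-- Fully k-rooted cuttable k-permutations are evaluations

side : ℕ → ℕ → Dir
side γ x with x ≤? γ
... | yes _ = ≺
... | no _  = ≻

shuffle-by-side : ∀ {γ n} α B D → All (InRange 1 n) α →
  shuffle (map (side γ) α) (restrict 1 γ α ++ B) (shift γ (restrict (suc γ) n α) ++ D) ≡ α ++ B ++ D
shuffle-by-side [] B D [] = refl
shuffle-by-side {γ} {n} (x ∷ α) B D ((1≤x , x≤n) ∷ α∈) with x ≤? γ
... | yes x≤γ
  rewrite restrict-∷⁺ {1} {γ} α (1≤x , x≤γ) | restrict-∷⁻ {suc γ} {n} α (λ (γ<x , _) → <⇒≱ γ<x x≤γ) =
  cong₂ _∷_ (m+[1+[n∸1+m]]≡n 1≤x) (shuffle-by-side α B D α∈)
... | no x≰γ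
  rewrite restrict-∷⁻ {1} {γ} α (x≰γ ∘ proj₂) | restrict-∷⁺ {suc γ} {n} α (≰⇒> x≰γ , x≤n) =
  cong₂ _∷_ (m+[1+[n∸1+m]]≡n (≰⇒> x≰γ)) (shuffle-by-side α B D α∈)

rootedCut⇒shuffle : ∀ {k n γ ρ} → All (InRange 1 n) ρ → IsKRootedCut k n ρ γ →
  Σ (Op k) λ ω → shuffle (toList ω) (restrict 1 γ ρ) (shift γ (restrict (suc γ) n ρ)) ≡ ρ
rootedCut⇒shuffle {k} {n} {γ} ρ∈ (_ , _ , α , β , δ , refl , |α|≡k , β≤γ , γ<δ)
  with vec-of-length (map (side γ) α) (trans (length-map (side γ) α) |α|≡k)
... | ω , ω≡ =
  ω , trans (cong₂ (shuffle (toList ω)) lower upper)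
            (trans (cong (λ w → shuffle w _ _) ω≡) (shuffle-by-side α β δ α∈))
  where
  α∈ = ++⁻ˡ α ρ∈
  β∈ = ++⁻ˡ β (++⁻ʳ α ρ∈)
  δ∈ = ++⁻ʳ β (++⁻ʳ α ρ∈)
  lower : restrict 1 γ (α ++ β ++ δ) ≡ restrict 1 γ α ++ β
  lower = begin
    restrict 1 γ (α ++ β ++ δ)                          ≡⟨ restrict-++-++ 1 γ α β δ ⟩
    restrict 1 γ α ++ restrict 1 γ β ++ restrict 1 γ δ
      ≡⟨ cong₂ (λ u v → restrict 1 γ α ++ u ++ v)
           (restrict-id (All.zipWith (λ ((1≤x , _) , x≤γ) → 1≤x , x≤γ) (β∈ , β≤γ)))
           (restrict-none (All.map (λ γ<x (_ , x≤γ) → <⇒≱ γ<x x≤γ) γ<δ)) ⟩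
    restrict 1 γ α ++ β ++ []                           ≡⟨ cong (restrict 1 γ α ++_) (++-identityʳ β) ⟩
    restrict 1 γ α ++ β                                 ∎
  upper : shift γ (restrict (suc γ) n (α ++ β ++ δ)) ≡ shift γ (restrict (suc γ) n α) ++ δ
  upper = begin
    shift γ (restrict (suc γ) n (α ++ β ++ δ))
      ≡⟨ cong (shift γ) (restrict-++-++ (suc γ) n α β δ) ⟩
    shift γ (restrict (suc γ) n α ++ restrict (suc γ) n β ++ restrict (suc γ) n δ)
      ≡⟨ cong (λ u → shift γ (restrict (suc γ) n α ++ u ++ restrict (suc γ) n δ))
           (restrict-none (All.map (λ x≤γ (γ<x , _) → <⇒≱ γ<x x≤γ) β≤γ)) ⟩
    shift γ (restrict (suc γ) n α ++ restrict (suc γ) n δ)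
      ≡⟨ map-++ (γ +_) (restrict (suc γ) n α) (restrict (suc γ) n δ) ⟩
    shift γ (restrict (suc γ) n α) ++ shift γ (restrict (suc γ) n δ)
      ≡⟨ cong (shift γ (restrict (suc γ) n α) ++_)
           (shift-restrict (All.zipWith (λ (γ<x , (_ , x≤n)) → γ<x , x≤n) (γ<δ , δ∈))) ⟩
    shift γ (restrict (suc γ) n α) ++ δ ∎

fullyKRootedCuttable⇒TEval : ∀ {k} n {ρ} → 1 ≤ n → IsKPerm k n ρ → FullyKRootedCuttable k n ρ →
  Σ (Tree k) λ t → degree t ≡ n × TEval k t ≡ ρ
fullyKRootedCuttable⇒TEval {k} = <-rec Goal step
  where
  Goal : ℕ → Set
  Goal n = ∀ {ρ} → 1 ≤ n → IsKPerm k n ρ → FullyKRootedCuttable k n ρ →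
    Σ (Tree k) λ t → degree t ≡ n × TEval k t ≡ ρ
  step : ∀ n → (∀ {m} → m < n → Goal m) → Goal n
  step (suc zero) _ _ ρ-perm _ = leaf , refl , sym (isKPerm-degree-one ρ-perm)
  step n@(suc (suc n')) IH {ρ} _ ρ-perm@(ρ∈ , _) F
    with subst (KRootedCuttable k n) (restrict-id ρ∈) (F 1 n ≤-refl (s≤s (s≤s z≤n)) ≤-refl)
  ... | γ@(suc g) , cut@(_ , γ<n , _) with rootedCut⇒shuffle ρ∈ cut
  ...   | ω , shuffled
    with IH γ<n (s≤s z≤n)
            (isKPerm-restrict ρ-perm ≤-refl (s≤s z≤n) (<⇒≤ γ<n))
            (fullyKRootedCuttable-restrict {ρ = ρ} F ≤-refl (s≤s z≤n) (<⇒≤ γ<n))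
       | IH (s≤s (s≤s (m∸n≤m n' g))) (s≤s z≤n)
            (isKPerm-restrict ρ-perm (s≤s z≤n) γ<n ≤-refl)
            (fullyKRootedCuttable-restrict {ρ = ρ} F (s≤s z≤n) γ<n ≤-refl)
  ...     | l , deg-l , l↦ | r , deg-r , r↦ =
    node ω l r ,
    trans (cong₂ _+_ deg-l deg-r) (m+[1+[n∸1+m]]≡n γ<n) ,
    trans (cong₂ (shuffle (toList ω)) l↦ (cong₂ shift deg-l r↦)) shuffled

proposition5p49 : (k : ℕ) → 1 ≤ k → (n : ℕ) → 1 ≤ n → (ρ : Word) → IsKPerm k n ρ →
    ((∃ λ (t : Tree k) → TEval k t ≡ ρ) ⇔ FullyKRootedCuttable k n ρ)
proposition5p49 k _ n 1≤n ρ ρ-perm = mk⇔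
  (λ (t , TEval≡ρ) → subst (FullyKRootedCuttable k n) TEval≡ρ
                       (TEval⇒fullyKRootedCuttable t (subst (IsKPerm k n) (sym TEval≡ρ) ρ-perm)))
  (λ F → let t , _ , TEval≡ρ = fullyKRootedCuttable⇒TEval n 1≤n ρ-perm F in t , TEval≡ρ)
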